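{- wBIL is the logic preserving degrees of truth over $\mathcal{BHA}$: for every set of formulas $\Gamma$ and formula $\phi$, $\Gamma\vdash_w\phi$ iff there exists a finite $\Gamma'\subseteq\Gamma$ such that for every $A\in\mathcal{BHA}$, every valuation $v$ on $A$ and every $a\in A$, if $a\le\bar v(\gamma)$ for all $\gamma\in\Gamma'$ then $a\le\bar v(\phi)$.
   Context: Fix a countably infinite set $\mathrm{Prop}$ of propositional variables. Bi-intuitionistic formulas are generated by $\phi ::= p \mid \bot \mid \top \mid \phi\wedge\phi \mid \phi\vee\phi \mid \phi\to\phi \mid \phi\prec\phi$ with $p\in\mathrm{Prop}$ ($\prec$ is exclusion). Abbreviations: $\neg\phi := \phi\to\bot$, ${\sim}\phi := \top\prec\phi$. An axiom is any instance of: (A1) $\phi\to(\psi\to\phi)$; (A2) $(\phi\to(\psi\to\chi))\to((\phi\to\psi)\to(\phi\to\chi))$; (A3) $\phi\to(\phi\vee\psi)$; (A4) $\psi\to(\phi\vee\psi)$; (A5) $(\phi\to\chi)\to((\psi\to\chi)\to((\phi\vee\psi)\to\chi))$; (A6) $(\phi\wedge\psi)\to\phi$; (A7) $(\phi\wedge\psi)\to\psi$; (A8) $(\chi\to\phi)\to((\chi\to\psi)\to(\chi\to(\phi\wedge\psi)))$; (A9) $\bot\to\phi$; (A10) $\phi\to\top$; (A11) $\phi\to(\psi\vee(\phi\prec\psi))$; (A12) $(\phi\prec\psi)\to{\sim}(\phi\to\psi)$; (A13) $((\phi\prec\psi)\prec\chi)\to(\phi\prec(\psi\vee\chi))$; (A14)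 $\neg(\phi\prec\psi)\to(\phi\to\psi)$. wBIL is the relation $\Gamma\vdash_w\phi$ holding iff $\Gamma\vdash\phi$ is derivable with: (Ax) $\Gamma\vdash\phi$ for any axiom $\phi$; (El) $\Gamma\vdash\phi$ if $\phi\in\Gamma$; (MP) from $\Gamma\vdash\phi$ and $\Gamma\vdash\phi\to\psi$ infer $\Gamma\vdash\psi$; (wDN) from $\emptyset\vdash\phi$ infer $\Gamma\vdash\neg{\sim}\phi$. A bi-Heyting algebra is an algebra $(A,\top,\bot,\wedge,\vee,\to,\prec)$ whose reduct $(A,\top,\bot,\wedge,\vee)$ is a bounded lattice (order $a\le b$ iff $a=a\wedge b$) with $a\wedge b\le c\iff a\le b\to c$ and $a\le b\vee c\iff a\prec b\le c$ for all $a,b,c$; $\mathcal{BHA}$ is the class of all bi-Heyting algebras. A valuation $v:\mathrm{Prop}\to A$ extends to $\bar v$ on formulas. -}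

module Defs where

open import Level using (Level; 0ℓ; suc; _⊔_)
open import Data.Nat using (ℕ)
open import Data.Empty using () renaming (⊥ to Empty)
open import Data.Product using (_×_)
open import Relation.Unary using (Pred)
open import Relation.Binary using (Rel; IsEquivalence)
open import Algebra.Core using (Op₂)
open import Algebra.Lattice.Structures using (IsLattice)
open import Function.Bundles using (_⇔_)

infixr 6 _∧̇_
infixr 5 _∨̇_
infixr 4 _⇒̇_ _≺̇_

data Formula : Set where
  var  : ℕ → Formula
  ⊥̇ ⊤̇ : Formula
  _∧̇_ _∨̇_ _⇒̇_ _≺̇_ : Formula → Formula → Formula

¬̇_ : Formula → Formula
¬̇ φ = φ ⇒̇ ⊥̇

∼̇_ : Formula → Formula
∼̇ φ = ⊤̇ ≺̇ φ

data Axiom : Formula → Set where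
  A1  : ∀ φ ψ → Axiom (φ ⇒̇ (ψ ⇒̇ φ))
  A2  : ∀ φ ψ χ → Axiom ((φ ⇒̇ (ψ ⇒̇ χ)) ⇒̇ ((φ ⇒̇ ψ) ⇒̇ (φ ⇒̇ χ)))
  A3  : ∀ φ ψ → Axiom (φ ⇒̇ (φ ∨̇ ψ))
  A4  : ∀ φ ψ → Axiom (ψ ⇒̇ (φ ∨̇ ψ))
  A5  : ∀ φ ψ χ → Axiom ((φ ⇒̇ χ) ⇒̇ ((ψ ⇒̇ χ) ⇒̇ ((φ ∨̇ ψ) ⇒̇ χ)))
  A6  : ∀ φ ψ → Axiom ((φ ∧̇ ψ) ⇒̇ φ)
  A7  : ∀ φ ψ → Axiom ((φ ∧̇ ψ) ⇒̇ ψ)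
  A8  : ∀ φ ψ χ → Axiom ((χ ⇒̇ φ) ⇒̇ ((χ ⇒̇ ψ) ⇒̇ (χ ⇒̇ (φ ∧̇ ψ))))
  A9  : ∀ φ → Axiom (⊥̇ ⇒̇ φ)
  A10 : ∀ φ → Axiom (φ ⇒̇ ⊤̇)
  A11 : ∀ φ ψ → Axiom (φ ⇒̇ (ψ ∨̇ (φ ≺̇ ψ)))
  A12 : ∀ φ ψ → Axiom ((φ ≺̇ ψ) ⇒̇ ∼̇ (φ ⇒̇ ψ))
  A13 : ∀ φ ψ χ → Axiom (((φ ≺̇ ψ) ≺̇ χ) ⇒̇ (φ ≺̇ (ψ ∨̇ χ)))
  A14 : ∀ φ ψ → Axiom (¬̇ (φ ≺̇ ψ) ⇒̇ (φ ⇒̇ ψ))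

∅ : Pred Formula 0ℓ
∅ _ = Empty

infix 2 _⊢w_

data _⊢w_ (Γ : Pred Formula 0ℓ) : Formula → Set where
  ax  : ∀ {φ} → Axiom φ → Γ ⊢w φ
  el  : ∀ {φ} → Γ φ → Γ ⊢w φ
  mp  : ∀ {φ ψ} → Γ ⊢w φ → Γ ⊢w (φ ⇒̇ ψ) → Γ ⊢w ψ
  wDN : ∀ {φ} → ∅ ⊢w φ → Γ ⊢w ¬̇ ∼̇ φ

record BHA (c ℓ : Level) : Set (suc (c ⊔ ℓ)) where
  infixr 6 _∧_
  infixr 5 _∨_
  infixr 4 _⇒_ _≺_
  infix 3 _≈_ _≤_
  field
    Carrier : Set c
    _≈_     : Rel Carrier ℓ
    ⊤ ⊥     : Carrier
    _∧_ _∨_ _⇒_ _≺_ : Op₂ Carrier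
    isLattice : IsLattice _≈_ _∨_ _∧_
    ∧-identityʳ : ∀ a → (a ∧ ⊤) ≈ a
    ∨-identityʳ : ∀ a → (a ∨ ⊥) ≈ a
    ⇒-cong : ∀ {a a' b b'} → a ≈ a' → b ≈ b' → (a ⇒ b) ≈ (a' ⇒ b')
    ≺-cong : ∀ {a a' b b'} → a ≈ a' → b ≈ b' → (a ≺ b) ≈ (a' ≺ b')

  _≤_ : Rel Carrier ℓ
  a ≤ b = a ≈ (a ∧ b)

  field
    residuation   : ∀ a b c → ((a ∧ b) ≤ c) ⇔ (a ≤ (b ⇒ c))
    coresiduation : ∀ a b c → (a ≤ (b ∨ c)) ⇔ ((a ≺ b) ≤ c)

module _ {c ℓ} (A : BHA c ℓ) where
  open BHA A

  ⟦_⟧ : Formula → (ℕ → Carrier) → Carrier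
  ⟦ var p ⟧ v = v p
  ⟦ ⊥̇ ⟧ v = ⊥
  ⟦ ⊤̇ ⟧ v = ⊤
  ⟦ φ ∧̇ ψ ⟧ v = ⟦ φ ⟧ v ∧ ⟦ ψ ⟧ v
  ⟦ φ ∨̇ ψ ⟧ v = ⟦ φ ⟧ v ∨ ⟦ ψ ⟧ v
  ⟦ φ ⇒̇ ψ ⟧ v = ⟦ φ ⟧ v ⇒ ⟦ ψ ⟧ v
  ⟦ φ ≺̇ ψ ⟧ v = ⟦ φ ⟧ v ≺ ⟦ ψ ⟧ v

-- Soundness: in a bi-Heyting algebra every axiom denotes ⊤, modus ponens
-- preserves "lies above a", and wDN is sound because a theorem φ denotes ⊤,
-- whence ∼φ = ⊤ ≺ φ = ⊥.  The finite Γ' collects the premises a derivation uses.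
--
-- Completeness: provable implication φ ⊑ ψ (from no premises) makes formulas
-- into a bi-Heyting algebra, the Lindenbaum algebra.  The deduction theorem
-- holds because wDN only applies to theorems, and co-residuation follows from
-- A11–A14 together with wDN.  Evaluating in this algebra under the valuation
-- p ↦ p and taking a := ⋀Γ' yields ⊢ ⋀Γ' → φ, hence Γ ⊢w φ.
module Submission where

open import Defs
open import Level using (Level; 0ℓ)
open import Data.Nat using (ℕ)
open import Data.List using (List; []; _∷_; _++_; foldr)
open import Data.List.Relation.Unary.All as All using (All; []; _∷_)
open import Data.List.Relation.Unary.All.Properties using (++⁺; ++⁻ˡ; ++⁻ʳ)
open import Data.Product using (∃-syntax; _×_; _,_)
open import Data.Sum using (inj₁; inj₂)
open import Function using (_∘_)
open import Function.Bundles using (_⇔_; mk⇔; Equivalence)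
open import Relation.Binary.PropositionalEquality as ≡ using (_≡_)
open import Relation.Unary using (Pred; _⊆_; _∪_; ｛_｝)
open import Relation.Binary.Construct.Interior.Symmetric as SymInterior
  using (SymInterior; _,_)
import Algebra.Lattice.Properties.Lattice as AlgLatticeProperties
open import Relation.Binary.Lattice using (HeytingAlgebra)
import Relation.Binary.Lattice as Ord
import Relation.Binary.Lattice.Properties.HeytingAlgebra as HeytingAlgebraProperties
import Relation.Binary.Lattice.Properties.Lattice as OrdLatticeProperties

private
  variable
    φ ψ χ φ' ψ' : Formula
    Γ Δ : Pred Formula 0ℓ
    Θ : List Formula

module BiHeytingAlgebraProperties {c ℓ : Level} (B : BHA c ℓ) where

  open BHA B using (_≺_; isLattice; ∧-identityʳ; ∨-identityʳ; residuation; coresiduation)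

  -- BHA._≤_ is definitionally the natural order of ∧ that
  -- ∨-∧-orderTheoreticLattice uses, so the Heyting reduct fits as is.
  heytingAlgebra : HeytingAlgebra c ℓ ℓ
  heytingAlgebra = record
    { isHeytingAlgebra = record
      { isBoundedLattice = record
        { isLattice = Ord.Lattice.isLattice orderLattice
        ; maximum   = λ x → Eq.sym (∧-identityʳ x)
        ; minimum   = λ x → ≤-respʳ-≈ (∨-identityʳ x) (y≤x∨y x ⊥)
        }
      ; exponential = λ w x y → Equivalence.to (residuation w x y)
                              , Equivalence.from (residuation w x y)
      }
    }
    where
    open BHA B using (⊥; _≈_)
    orderLattice : Ord.Lattice c ℓ ℓ
    orderLattice = AlgLatticeProperties.∨-∧-orderTheoreticLattice
                     (record { isLattice = isLattice })
    open Ord.Lattice orderLattice using (module Eq; y≤x∨y; ≤-respʳ-≈)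

  open HeytingAlgebra heytingAlgebra public
  open HeytingAlgebraProperties heytingAlgebra public
  open import Relation.Binary.Lattice.Properties.MeetSemilattice meetSemilattice
    using (∧-comm; ∧-monotonic)
  open import Relation.Binary.Lattice.Properties.JoinSemilattice joinSemilattice
    using (∨-assoc)

  transpose-≺ : ∀ {x y z} → x ≤ y ∨ z → (x ≺ y) ≤ z
  transpose-≺ {x} {y} {z} = Equivalence.to (coresiduation x y z)

  transpose-∨ : ∀ {x y z} → (x ≺ y) ≤ z → x ≤ y ∨ z
  transpose-∨ {x} {y} {z} = Equivalence.from (coresiduation x y z)

  x≤y∨x≺y : ∀ {x y} → x ≤ y ∨ (x ≺ y)
  x≤y∨x≺y = transpose-∨ refl

  ⊤≤⇨ : ∀ {x y} → x ≤ y → ⊤ ≤ x ⇨ y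
  ⊤≤⇨ {x} x≤y = transpose-⇨ (trans (x∧y≤y ⊤ x) x≤y)

  ⇨-mp : ∀ {a x y} → a ≤ x → a ≤ x ⇨ y → a ≤ y
  ⇨-mp a≤x a≤x⇨y = trans (∧-greatest a≤x⇨y a≤x) ⇨-eval

  ⇨-distribˡ-⇨-≤ : ∀ {x y z} → x ⇨ y ⇨ z ≤ (x ⇨ y) ⇨ x ⇨ z
  ⇨-distribˡ-⇨-≤ {x} {y} {z} = transpose-⇨ (transpose-⇨ (⇨-mp
    (transpose-∧ (x∧y≤y (x ⇨ y ⇨ z) (x ⇨ y)))
    (transpose-∧ (x∧y≤x (x ⇨ y ⇨ z) (x ⇨ y)))))

  ≺-≤-∼⇨ : ∀ {x y} → (x ≺ y) ≤ (⊤ ≺ (x ⇨ y))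
  ≺-≤-∼⇨ {x} {y} = transpose-≺ (begin
    x                           ≤⟨ ∧-greatest (maximum x) refl ⟩
    ⊤ ∧ x                       ≤⟨ ∧-monotonic (trans x≤y∨x≺y ⇨∨∼≤⇨∨) refl ⟩
    (x ⇨ y ∨ ∼[x⇨y]) ∧ x        ≤⟨ ⇨-eval ⟩
    y ∨ ∼[x⇨y]                  ∎)
    where
    open import Relation.Binary.Reasoning.PartialOrder poset
    ∼[x⇨y] : Carrier
    ∼[x⇨y] = ⊤ ≺ (x ⇨ y)
    ⇨∨∼≤⇨∨ : (x ⇨ y) ∨ ∼[x⇨y] ≤ x ⇨ y ∨ ∼[x⇨y]
    ⇨∨∼≤⇨∨ = ∨-least (⇨ʳ-covariant (x≤x∨y y ∼[x⇨y]))
                     (trans (y≤x∨y y ∼[x⇨y]) y≤x⇨y)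

  ≺-curry-≤ : ∀ {x y z} → ((x ≺ y) ≺ z) ≤ (x ≺ (y ∨ z))
  ≺-curry-≤ {x} {y} {z} = transpose-≺ (transpose-≺
    (trans x≤y∨x≺y (reflexive (∨-assoc y z (x ≺ (y ∨ z))))))

  ¬≺≤⇨ : ∀ {x y} → ¬ (x ≺ y) ≤ x ⇨ y
  ¬≺≤⇨ {x} {y} = swap-transpose-⇨ (transpose-∧ (trans x≤y∨x≺y
    (∨-least y≤x⇨y (transpose-⇨ (trans x≺y∧¬x≺y≤⊥ (minimum y))))))
    where
    x≺y∧¬x≺y≤⊥ : (x ≺ y) ∧ ¬ (x ≺ y) ≤ ⊥
    x≺y∧¬x≺y≤⊥ = trans (reflexive (∧-comm _ _)) ⇨-eval

  module _ (v : ℕ → Carrier) where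

    axiom-valid : Axiom φ → ⊤ ≤ ⟦_⟧ B φ v
    axiom-valid (A1 _ _)    = ⊤≤⇨ y≤x⇨y
    axiom-valid (A2 _ _ _)  = ⊤≤⇨ ⇨-distribˡ-⇨-≤
    axiom-valid (A3 _ _)    = ⊤≤⇨ (x≤x∨y _ _)
    axiom-valid (A4 _ _)    = ⊤≤⇨ (y≤x∨y _ _)
    axiom-valid (A5 _ _ _)  = ⊤≤⇨ (transpose-⇨ (⇨-distribˡ-∨-∧-≥ _ _ _))
    axiom-valid (A6 _ _)    = ⊤≤⇨ (x∧y≤x _ _)
    axiom-valid (A7 _ _)    = ⊤≤⇨ (x∧y≤y _ _)
    axiom-valid (A8 _ _ _)  = ⊤≤⇨ (transpose-⇨ (⇨-distribˡ-∧-≥ _ _ _))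
    axiom-valid (A9 _)      = ⊤≤⇨ (minimum _)
    axiom-valid (A10 _)     = ⊤≤⇨ (maximum _)
    axiom-valid (A11 _ _)   = ⊤≤⇨ x≤y∨x≺y
    axiom-valid (A12 _ _)   = ⊤≤⇨ ≺-≤-∼⇨
    axiom-valid (A13 _ _ _) = ⊤≤⇨ ≺-curry-≤
    axiom-valid (A14 _ _)   = ⊤≤⇨ ¬≺≤⇨

  ⊤≤¬∼ : ∀ {x} → ⊤ ≤ x → ⊤ ≤ ¬ (⊤ ≺ x)
  ⊤≤¬∼ {x} ⊤≤x = ⊤≤⇨ (transpose-≺ (trans ⊤≤x (x≤x∨y x ⊥)))

infix 3 _⊨_

_⊨_ : List Formula → Formula → Set₁
Θ ⊨ φ = (A : BHA 0ℓ 0ℓ) (v : ℕ → BHA.Carrier A) (a : BHA.Carrier A) →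
  All (λ γ → BHA._≤_ A a (⟦_⟧ A γ v)) Θ → BHA._≤_ A a (⟦_⟧ A φ v)

sound : Γ ⊢w φ → ∃[ Θ ] (All Γ Θ × Θ ⊨ φ)
sound (ax α) = [] , [] , λ A v a _ →
  let open BiHeytingAlgebraProperties A in trans (maximum a) (axiom-valid v α)
sound (el γ) = _ , γ ∷ [] , λ { A v a (a≤γ ∷ []) → a≤γ }
sound (mp d e) with sound d | sound e
... | Θ₁ , Γ⊇Θ₁ , Θ₁⊨φ | Θ₂ , Γ⊇Θ₂ , Θ₂⊨φ⇒ψ =
  Θ₁ ++ Θ₂ , ++⁺ Γ⊇Θ₁ Γ⊇Θ₂ , λ A v a a≤Θ → BiHeytingAlgebraProperties.⇨-mp A
    (Θ₁⊨φ A v a (++⁻ˡ Θ₁ a≤Θ)) (Θ₂⊨φ⇒ψ A v a (++⁻ʳ Θ₁ a≤Θ))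
sound (wDN d) with sound d
... | [] , [] , ⊨φ = [] , [] , λ A v a _ →
  let open BiHeytingAlgebraProperties A
  in trans (maximum a) (⊤≤¬∼ (⊨φ A v ⊤ []))

weaken : Γ ⊆ Δ → Γ ⊢w φ → Δ ⊢w φ
weaken Γ⊆Δ (ax α)   = ax α
weaken Γ⊆Δ (el γ)   = el (Γ⊆Δ γ)
weaken Γ⊆Δ (mp d e) = mp (weaken Γ⊆Δ d) (weaken Γ⊆Δ e)
weaken Γ⊆Δ (wDN d)  = wDN d

∅⊢⇒⊢ : ∅ ⊢w φ → Γ ⊢w φ
∅⊢⇒⊢ = weaken λ ()

⊢-hyp : Γ ∪ ｛ φ ｝ ⊢w φ
⊢-hyp = el (inj₂ ≡.refl)

⊢-K : Γ ⊢w ψ → Γ ⊢w φ ⇒̇ ψ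
⊢-K {ψ = ψ} {φ = φ} d = mp d (ax (A1 ψ φ))

⊢-I : Γ ⊢w φ ⇒̇ φ
⊢-I {φ = φ} = mp (ax (A1 φ φ)) (mp (ax (A1 φ (φ ⇒̇ φ))) (ax (A2 φ (φ ⇒̇ φ) φ)))

⊢-⊤ : Γ ⊢w ⊤̇
⊢-⊤ = mp ⊢-I (ax (A10 (⊥̇ ⇒̇ ⊥̇)))

⊢-∧ : Γ ⊢w φ → Γ ⊢w ψ → Γ ⊢w φ ∧̇ ψ
⊢-∧ {φ = φ} {ψ = ψ} d e = mp ⊢-⊤ (mp (⊢-K e) (mp (⊢-K d) (ax (A8 φ ψ ⊤̇))))

-- wDN ignores the context, which is why the deduction theorem survives it.
deduction : Γ ∪ ｛ ψ ｝ ⊢w φ → Γ ⊢w ψ ⇒̇ φ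
deduction (ax α)             = ⊢-K (ax α)
deduction (el (inj₁ γ))      = ⊢-K (el γ)
deduction (el (inj₂ ≡.refl)) = ⊢-I
deduction {ψ = ψ} (mp {φ} {χ} d e) =
  mp (deduction d) (mp (deduction e) (ax (A2 ψ φ χ)))
deduction (wDN d)            = ⊢-K (wDN d)

infix 3 _⊑_ _≋_

_⊑_ : Formula → Formula → Set
φ ⊑ ψ = ∅ ⊢w φ ⇒̇ ψ

⊑-refl : φ ⊑ φ
⊑-refl = ⊢-I

⊑-trans : φ ⊑ ψ → ψ ⊑ χ → φ ⊑ χ
⊑-trans φ⊑ψ ψ⊑χ = deduction (mp (mp ⊢-hyp (∅⊢⇒⊢ φ⊑ψ)) (∅⊢⇒⊢ ψ⊑χ))

x∧̇y⊑x : φ ∧̇ ψ ⊑ φ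
x∧̇y⊑x = ax (A6 _ _)

x∧̇y⊑y : φ ∧̇ ψ ⊑ ψ
x∧̇y⊑y = ax (A7 _ _)

∧̇-greatest : χ ⊑ φ → χ ⊑ ψ → χ ⊑ φ ∧̇ ψ
∧̇-greatest χ⊑φ χ⊑ψ = mp χ⊑ψ (mp χ⊑φ (ax (A8 _ _ _)))

x⊑x∨̇y : φ ⊑ φ ∨̇ ψ
x⊑x∨̇y = ax (A3 _ _)

y⊑x∨̇y : ψ ⊑ φ ∨̇ ψ
y⊑x∨̇y = ax (A4 _ _)

∨̇-least : φ ⊑ χ → ψ ⊑ χ → φ ∨̇ ψ ⊑ χ
∨̇-least φ⊑χ ψ⊑χ = mp ψ⊑χ (mp φ⊑χ (ax (A5 _ _ _)))

⊑-curry : φ ∧̇ ψ ⊑ χ → φ ⊑ ψ ⇒̇ χ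
⊑-curry φ∧ψ⊑χ = deduction (deduction (mp (⊢-∧ (weaken inj₁ ⊢-hyp) ⊢-hyp) (∅⊢⇒⊢ φ∧ψ⊑χ)))

⊑-uncurry : φ ⊑ ψ ⇒̇ χ → φ ∧̇ ψ ⊑ χ
⊑-uncurry φ⊑ψ⇒χ = deduction
  (mp (mp ⊢-hyp (∅⊢⇒⊢ x∧̇y⊑y)) (mp (mp ⊢-hyp (∅⊢⇒⊢ x∧̇y⊑x)) (∅⊢⇒⊢ φ⊑ψ⇒χ)))

-- By A13 and A12, (φ ≺ ψ) ≺ χ implies ∼(φ → ψ ∨ χ), which wDN refutes;
-- A14 turns this refutation into the implication.
⊑-transpose-≺ : φ ⊑ ψ ∨̇ χ → φ ≺̇ ψ ⊑ χ
⊑-transpose-≺ {φ} {ψ} {χ} φ⊑ψ∨χ = mp refuted (ax (A14 (φ ≺̇ ψ) χ))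
  where
  refuted : (φ ≺̇ ψ) ≺̇ χ ⊑ ⊥̇
  refuted = ⊑-trans (ax (A13 φ ψ χ)) (⊑-trans (ax (A12 φ (ψ ∨̇ χ))) (wDN φ⊑ψ∨χ))

⊑-transpose-∨ : φ ≺̇ ψ ⊑ χ → φ ⊑ ψ ∨̇ χ
⊑-transpose-∨ φ≺ψ⊑χ = ⊑-trans (ax (A11 _ _)) (∨̇-least x⊑x∨̇y (⊑-trans φ≺ψ⊑χ y⊑x∨̇y))

⇒̇-mono : φ' ⊑ φ → ψ ⊑ ψ' → φ ⇒̇ ψ ⊑ φ' ⇒̇ ψ'
⇒̇-mono φ'⊑φ ψ⊑ψ' = deduction (deduction
  (mp (mp (mp ⊢-hyp (∅⊢⇒⊢ φ'⊑φ)) (weaken inj₁ ⊢-hyp)) (∅⊢⇒⊢ ψ⊑ψ')))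

≺̇-mono : φ ⊑ φ' → ψ' ⊑ ψ → φ ≺̇ ψ ⊑ φ' ≺̇ ψ'
≺̇-mono φ⊑φ' ψ'⊑ψ = ⊑-transpose-≺
  (⊑-trans φ⊑φ' (⊑-trans (ax (A11 _ _)) (∨̇-least (⊑-trans ψ'⊑ψ x⊑x∨̇y) y⊑x∨̇y)))

_≋_ : Formula → Formula → Set
_≋_ = SymInterior _⊑_

⊑-lattice : Ord.Lattice 0ℓ 0ℓ 0ℓ
⊑-lattice = record
  { Carrier = Formula
  ; _≈_ = _≋_
  ; _≤_ = _⊑_
  ; _∨_ = _∨̇_
  ; _∧_ = _∧̇_
  ; isLattice = record
    { isPartialOrder = SymInterior.isPartialOrder ⊑-refl ⊑-trans
    ; supremum = λ _ _ → x⊑x∨̇y , y⊑x∨̇y , λ _ → ∨̇-least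
    ; infimum  = λ _ _ → x∧̇y⊑x , x∧̇y⊑y , λ _ → ∧̇-greatest
    }
  }

⊑⇒≤ : φ ⊑ ψ → φ ≋ (φ ∧̇ ψ)
⊑⇒≤ φ⊑ψ = ∧̇-greatest ⊑-refl φ⊑ψ , x∧̇y⊑x

≤⇒⊑ : φ ≋ (φ ∧̇ ψ) → φ ⊑ ψ
≤⇒⊑ (φ⊑φ∧ψ , _) = ⊑-trans φ⊑φ∧ψ x∧̇y⊑y

lindenbaum : BHA 0ℓ 0ℓ
lindenbaum = record
  { Carrier = Formula
  ; _≈_ = _≋_
  ; ⊤ = ⊤̇
  ; ⊥ = ⊥̇
  ; _∧_ = _∧̇_
  ; _∨_ = _∨̇_
  ; _⇒_ = _⇒̇_
  ; _≺_ = _≺̇_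
  ; isLattice = OrdLatticeProperties.isAlgLattice ⊑-lattice
  ; ∧-identityʳ = λ _ → x∧̇y⊑x , ∧̇-greatest ⊑-refl (ax (A10 _))
  ; ∨-identityʳ = λ _ → ∨̇-least ⊑-refl (ax (A9 _)) , x⊑x∨̇y
  ; ⇒-cong = λ (φ⊑φ' , φ'⊑φ) (ψ⊑ψ' , ψ'⊑ψ) →
      ⇒̇-mono φ'⊑φ ψ⊑ψ' , ⇒̇-mono φ⊑φ' ψ'⊑ψ
  ; ≺-cong = λ (φ⊑φ' , φ'⊑φ) (ψ⊑ψ' , ψ'⊑ψ) →
      ≺̇-mono φ⊑φ' ψ'⊑ψ , ≺̇-mono φ'⊑φ ψ⊑ψ'
  ; residuation = λ _ _ _ →
      mk⇔ (⊑⇒≤ ∘ ⊑-curry ∘ ≤⇒⊑) (⊑⇒≤ ∘ ⊑-uncurry ∘ ≤⇒⊑)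
  ; coresiduation = λ _ _ _ →
      mk⇔ (⊑⇒≤ ∘ ⊑-transpose-≺ ∘ ≤⇒⊑) (⊑⇒≤ ∘ ⊑-transpose-∨ ∘ ≤⇒⊑)
  }

⟦⟧-var : ∀ φ → ⟦_⟧ lindenbaum φ var ≡ φ
⟦⟧-var (var p) = ≡.refl
⟦⟧-var ⊥̇       = ≡.refl
⟦⟧-var ⊤̇       = ≡.refl
⟦⟧-var (φ ∧̇ ψ) = ≡.cong₂ _∧̇_ (⟦⟧-var φ) (⟦⟧-var ψ)
⟦⟧-var (φ ∨̇ ψ) = ≡.cong₂ _∨̇_ (⟦⟧-var φ) (⟦⟧-var ψ)
⟦⟧-var (φ ⇒̇ ψ) = ≡.cong₂ _⇒̇_ (⟦⟧-var φ) (⟦⟧-var ψ)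
⟦⟧-var (φ ≺̇ ψ) = ≡.cong₂ _≺̇_ (⟦⟧-var φ) (⟦⟧-var ψ)

⊑⇒≤⟦⟧ : φ ⊑ ψ → BHA._≤_ lindenbaum φ (⟦_⟧ lindenbaum ψ var)
⊑⇒≤⟦⟧ {ψ = ψ} φ⊑ψ rewrite ⟦⟧-var ψ = ⊑⇒≤ φ⊑ψ

≤⟦⟧⇒⊑ : BHA._≤_ lindenbaum φ (⟦_⟧ lindenbaum ψ var) → φ ⊑ ψ
≤⟦⟧⇒⊑ {ψ = ψ} φ≤ψ rewrite ⟦⟧-var ψ = ≤⇒⊑ φ≤ψ

⋀ : List Formula → Formula
⋀ = foldr _∧̇_ ⊤̇

⋀-⊑ : ∀ Θ → All (⋀ Θ ⊑_) Θ
⋀-⊑ []      = []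
⋀-⊑ (_ ∷ Θ) = x∧̇y⊑x ∷ All.map (⊑-trans x∧̇y⊑y) (⋀-⊑ Θ)

⊢-⋀ : All Γ Θ → Γ ⊢w ⋀ Θ
⊢-⋀ []        = ⊢-⊤
⊢-⋀ (γ ∷ Γ⊇Θ) = ⊢-∧ (el γ) (⊢-⋀ Γ⊇Θ)

complete : All Γ Θ → Θ ⊨ φ → Γ ⊢w φ
complete {Θ = Θ} Γ⊇Θ Θ⊨φ = mp (⊢-⋀ Γ⊇Θ) (∅⊢⇒⊢ (≤⟦⟧⇒⊑
  (Θ⊨φ lindenbaum var (⋀ Θ) (All.map ⊑⇒≤⟦⟧ (⋀-⊑ Θ)))))

mainTheorem12 : (Γ : Pred Formula 0ℓ) (φ : Formula) →
    (Γ ⊢w φ) ⇔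
    (∃[ Γ' ] (All Γ Γ' ×
      ((A : BHA 0ℓ 0ℓ) (v : ℕ → BHA.Carrier A) (a : BHA.Carrier A) →
        All (λ γ → BHA._≤_ A a (⟦_⟧ A γ v)) Γ' →
        BHA._≤_ A a (⟦_⟧ A φ v))))
mainTheorem12 Γ φ = mk⇔ sound (λ (Θ , Γ⊇Θ , Θ⊨φ) → complete Γ⊇Θ Θ⊨φ)
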